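{- The map sending $(\pi,\rho,\lambda)\in\Pi^2_n$ to the word $w_1\cdots w_n$ defined by $w_i=\min B$ for all $B\in\pi$ and $i\in\lambda(B)$ is an $\mathfrak S_n$-equivariant bijection from $\Pi^2_n$ onto the set of parking functions of length $n$.
   Context: $\Pi_n$: set partitions of $\{1,\dots,n\}$; $NC_n$: noncrossing set partitions. $\Pi^2_n$ is the set of triples $(\pi,\rho,\lambda)$ with $\pi\in NC_n$, $\rho\in\Pi_n$, $\lambda$ a bijection from blocks of $\pi$ to blocks of $\rho$ with $|\lambda(B)|=|B|$; $\mathfrak S_n$ acts by $\sigma\cdot(\pi,\rho,\lambda)=(\pi,\sigma\cdot\rho,\sigma\circ\lambda)$ ($\sigma$ acting elementwise on sets). A parking function of length $n$ is a word $w_1\cdots w_n$ of positive integers with $\#\{i:w_i\leq k\}\geq k$ for all $1\leq k\leq n$; $\mathfrak S_n$ acts by $\sigma\cdot(w_1\cdots w_n)=w_{\sigma^{ -1}(1)}\cdots w_{\sigma^{ -1}(n)}$. -}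

module Defs where

open import Data.Nat as ℕ using (ℕ; zero; suc)
open import Data.Bool using (Bool; true; false; if_then_else_)
open import Data.Fin as Fin using (Fin)
open import Data.Fin.Subset using (Subset; _∈_; _∩_; Empty; Nonempty; ∣_∣)
open import Data.Fin.Subset.Properties using (_∈?_)
open import Data.Fin.Permutation using (Permutation′; _⟨$⟩ˡ_)
open import Data.Vec as Vec using (Vec; []; _∷_; lookup; tabulate; count)
open import Data.List as List using (List; []; _∷_)
open import Data.List.Relation.Unary.All using (All)
open import Data.List.Relation.Unary.Any using (Any)
open import Data.List.Relation.Unary.AllPairs using (AllPairs)
open import Data.List.Relation.Binary.Permutation.Propositional using (_↭_)
open import Data.Product using (_×_; _,_; proj₁; proj₂; Σ)
open import Data.Empty using (⊥)
open import Relation.Nullary using (does)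
open import Relation.Binary.PropositionalEquality using (_≡_)

-- Set partitions of {1,…,n} (encoded as Fin n, element i ↦ i+1).
-- A set partition is given as a list of its blocks (subsets of Fin n):
-- every block nonempty, blocks pairwise disjoint, blocks cover Fin n.
-- (Disjoint nonempty blocks are automatically distinct, so the list has
-- no repetitions; two lists describe the same partition iff they are
-- permutations of each other.)

Disjoint : ∀ {n} → Subset n → Subset n → Set
Disjoint B C = Empty (B ∩ C)

IsSetPartition : ∀ {n} → List (Subset n) → Set
IsSetPartition {n} P =
  All Nonempty P × AllPairs Disjoint P × (∀ (i : Fin n) → Any (i ∈_) P)

NoCrossing : ∀ {n} → Subset n → Subset n → Set
NoCrossing {n} B C = ∀ (a b c d : Fin n) →
  a Fin.< b → b Fin.< c → c Fin.< d →
  a ∈ B → c ∈ B → b ∈ C → d ∈ C → ⊥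

NonCrossingPair : ∀ {n} → Subset n → Subset n → Set
NonCrossingPair B C = NoCrossing B C × NoCrossing C B

IsNonCrossingPartition : ∀ {n} → List (Subset n) → Set
IsNonCrossingPartition P = IsSetPartition P × AllPairs NonCrossingPair P

-- A triple (π, ρ, λ) is encoded by the graph of λ, i.e. the list
-- of pairs (B, λ(B)) for B ∈ π.  Then π = map proj₁, ρ = map proj₂, and
-- λ is a bijection between blocks of π and blocks of ρ automatically.
-- Equality of triples is equality of graphs, i.e. list permutation _↭_.

Triple : ℕ → Set
Triple n = List (Subset n × Subset n)

InΠ² : ∀ {n} → Triple n → Set
InΠ² t =
  IsNonCrossingPartition (List.map proj₁ t) ×
  IsSetPartition (List.map proj₂ t) ×
  All (λ p → ∣ proj₁ p ∣ ≡ ∣ proj₂ p ∣) t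

-- action of σ ∈ 𝔖_n on subsets: σ·C = { σ(j) | j ∈ C }
actSubset : ∀ {n} → Permutation′ n → Subset n → Subset n
actSubset σ C = tabulate (λ k → lookup C (σ ⟨$⟩ˡ k))

-- σ·(π, ρ, λ) = (π, σ·ρ, σ∘λ): on graphs, (B, C) ↦ (B, σ·C)
actTriple : ∀ {n} → Permutation′ n → Triple n → Triple n
actTriple σ = List.map (λ p → proj₁ p , actSubset σ (proj₂ p))

-- minimum of a (nonempty) subset, as an element of {1,…,n}
minElt : ∀ {n} → Subset n → ℕ
minElt []          = zero
minElt (true  ∷ _) = suc zero
minElt (false ∷ v) = suc (minElt v)

letterAt : ∀ {n} → Triple n → Fin n → ℕ
letterAt []            i = zero
letterAt ((B , C) ∷ t) i = if does (i ∈? C) then minElt B else letterAt t i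

toWord : ∀ {n} → Triple n → Vec ℕ n
toWord t = tabulate (letterAt t)

IsParkingFunction : ∀ {n} → Vec ℕ n → Set
IsParkingFunction {n} w =
  (∀ (i : Fin n) → 1 ℕ.≤ lookup w i) ×
  (∀ (k : ℕ) → 1 ℕ.≤ k → k ℕ.≤ n → k ℕ.≤ count (ℕ._≤? k) w)

-- σ·(w_1⋯w_n) = w_{σ⁻¹(1)} ⋯ w_{σ⁻¹(n)}
actWord : ∀ {n} → Permutation′ n → Vec ℕ n → Vec ℕ n
actWord σ w = tabulate (λ i → lookup w (σ ⟨$⟩ˡ i))

-- Write β(x) for the minimum of the π-block of x, so that w_i = β(x) whenever i ∈ λ(B) and
-- x ∈ B.  Since |λ(B)| = |B|, every value occurs in w exactly as often as in β; with
-- β(x) ≤ x this gives #{i : w_i ≤ k} ≥ #{x : β(x) ≤ k} ≥ k.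
-- For a noncrossing π, β is determined by its fibre sizes: scanning from the left, x opens
-- a new block iff the value x occurs, and otherwise joins the last opened block that is not
-- yet full.  So w determines β, hence π, and ρ and λ are read off the fibres of w.
-- Conversely, running this scan with the multiplicities of a parking function builds β;
-- the parking condition is exactly what guarantees a block with room at every step.

{-# OPTIONS --safe #-}
module Submission where

open import Defs
open import Data.Nat using (ℕ)
open import Data.Vec using (Vec)
open import Data.Fin.Permutation using (Permutation′; _⟨$⟩ˡ_)
open import Data.List.Relation.Binary.Permutation.Propositional using (_↭_)
open import Data.Product using (_×_; Σ)
open import Relation.Binary.PropositionalEquality using (_≡_)

open import Data.Nat as ℕ using (zero; suc; _+_; _*_; _≤_; _<_; z≤n; s≤s; _≤?_; _<?_; _≟_)
open import Data.Nat.Properties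
open import Data.Fin as Fin using (Fin; toℕ)
open import Data.Fin.Properties using (toℕ<n; toℕ-injective; toℕ-fromℕ<)
open import Data.Vec as Vec using ([]; _∷_; lookup; tabulate; count; here; there)
open import Data.Vec.Properties using (lookup∘tabulate; tabulate∘lookup; tabulate-cong; lookup⇒[]=; []=⇒lookup)
open import Data.Fin.Subset using (Subset; _∈_; _∉_; _⊆_; ∣_∣; Nonempty)
open import Data.Fin.Subset.Properties using (_∈?_; x∈p∩q⁺; x∈p∩q⁻; ⊆-antisym)
open import Data.Product using (_,_; proj₁; proj₂; ∃)
open import Data.Bool using (true; false; if_then_else_) renaming (_≟_ to _≟ᵇ_)
open import Data.Sum using (_⊎_; inj₁; inj₂)
open import Data.Empty using (⊥; ⊥-elim)
open import Function using (_∘_; _on_; mk⇔)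
open import Data.List.Membership.Propositional.Properties.WithK using (unique∧set⇒bag)
open import Data.List.Relation.Binary.BagAndSetEquality using (∼bag⇒↭)
open import Data.List.Relation.Binary.Permutation.Propositional.Properties using (∈-resp-↭)
open import Data.List as List using (List; []; _∷_)
import Data.List.Properties as ListP
open import Data.Nat.ListAction using () renaming (sum to sumₗ)
open import Data.List.Relation.Unary.All as All using (All; []; _∷_)
open import Data.List.Relation.Unary.Any using (Any; here; there)
open import Data.List.Relation.Unary.AllPairs as AllPairs using (AllPairs; []; _∷_)
open import Data.List.Relation.Unary.Unique.Propositional using (Unique)
import Data.List.Relation.Unary.All.Properties as AllP
import Data.List.Relation.Unary.Any.Properties as AnyP
import Data.List.Relation.Unary.AllPairs.Properties as AllPairsP
open import Data.List.Membership.Propositional using (find; lose) renaming (_∈_ to _∈ₗ_)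
open import Data.List.Membership.Propositional.Properties using (∈-map⁺; ∈-filter⁺; ∈-filter⁻; ∈-applyUpTo⁺; ∈-applyUpTo⁻)
open import Relation.Nullary using (Dec; yes; no; ¬_; does)
open import Relation.Nullary.Decidable using (dec-true; dec-false)
open import Relation.Binary using (tri<; tri≈; tri>)
open import Relation.Binary.PropositionalEquality using (_≢_; refl; sym; trans; cong; cong₂; subst; subst₂; module ≡-Reasoning)
open import Algebra.Properties.Semiring.Sum +-*-semiring using (sum-syntax; sum-cong-≗; ∑-distrib-+; ∑-comm; *-distribˡ-sum)

-- Indicators and finite sums

𝟙 : ∀ {p} {P : Set p} → Dec P → ℕ
𝟙 (yes _) = 1
𝟙 (no _)  = 0

module _ {p} {P : Set p} where

  𝟙-yes : (d : Dec P) → P → 𝟙 d ≡ 1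
  𝟙-yes (yes _) _  = refl
  𝟙-yes (no ¬p) p = ⊥-elim (¬p p)

  𝟙-no : (d : Dec P) → ¬ P → 𝟙 d ≡ 0
  𝟙-no (yes p) ¬p = ⊥-elim (¬p p)
  𝟙-no (no _)  _  = refl

  𝟙≤1 : (d : Dec P) → 𝟙 d ≤ 1
  𝟙≤1 (yes _) = s≤s z≤n
  𝟙≤1 (no _)  = z≤n

  𝟙-pos : (d : Dec P) → 0 < 𝟙 d → P
  𝟙-pos (yes p) _ = p

𝟙-mono : ∀ {p q} {P : Set p} {Q : Set q} (d : Dec P) (e : Dec Q) → (P → Q) → 𝟙 d ≤ 𝟙 e
𝟙-mono (yes p) (yes _) _ = ≤-refl
𝟙-mono (yes p) (no ¬q) f = ⊥-elim (¬q (f p))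
𝟙-mono (no _)  _       _ = z≤n

𝟙-cong : ∀ {p q} {P : Set p} {Q : Set q} (d : Dec P) (e : Dec Q) → (P → Q) → (Q → P) → 𝟙 d ≡ 𝟙 e
𝟙-cong d e f g = ≤-antisym (𝟙-mono d e f) (𝟙-mono e d g)

𝟙-does : ∀ {p} {P : Set p} (d : Dec P) → 𝟙 (does d ≟ᵇ true) ≡ 𝟙 d
𝟙-does (yes _) = refl
𝟙-does (no _)  = refl

∑-cong : ∀ {n} {f g : Fin n → ℕ} → (∀ i → f i ≡ g i) → ∑[ i < n ] f i ≡ ∑[ i < n ] g i
∑-cong f≗g = sum-cong-≗ f≗g

∑-mono-≤ : ∀ {n} {f g : Fin n → ℕ} → (∀ i → f i ≤ g i) → ∑[ i < n ] f i ≤ ∑[ i < n ] g i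
∑-mono-≤ {zero}  _   = z≤n
∑-mono-≤ {suc n} f≤g = +-mono-≤ (f≤g Fin.zero) (∑-mono-≤ (f≤g ∘ Fin.suc))

∑-mono-< : ∀ {n} {f g : Fin n → ℕ} → (∀ i → f i ≤ g i) → ∀ j → f j < g j →
           ∑[ i < n ] f i < ∑[ i < n ] g i
∑-mono-< {suc n} f≤g Fin.zero    fj<gj = +-mono-<-≤ fj<gj (∑-mono-≤ (f≤g ∘ Fin.suc))
∑-mono-< {suc n} f≤g (Fin.suc j) fj<gj = +-mono-≤-< (f≤g Fin.zero) (∑-mono-< (f≤g ∘ Fin.suc) j fj<gj)

∑-≤∧≡⇒≗ : ∀ {n} {f g : Fin n → ℕ} → (∀ i → f i ≤ g i) → ∑[ i < n ] f i ≡ ∑[ i < n ] g i →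
          ∀ j → f j ≡ g j
∑-≤∧≡⇒≗ f≤g ∑f≡∑g j with m≤n⇒m<n∨m≡n (f≤g j)
... | inj₂ fj≡gj = fj≡gj
... | inj₁ fj<gj = ⊥-elim (<⇒≢ (∑-mono-< f≤g j fj<gj) ∑f≡∑g)

∑-const-0 : ∀ n → ∑[ i < n ] 0 ≡ 0
∑-const-0 zero    = refl
∑-const-0 (suc n) = ∑-const-0 n

∑-<⇒∃< : ∀ {n} (f g : Fin n → ℕ) → ∑[ i < n ] f i < ∑[ i < n ] g i → ∃ λ j → f j < g j
∑-<⇒∃< {suc n} f g ∑f<∑g with f Fin.zero <? g Fin.zero
... | yes f0<g0 = Fin.zero , f0<g0
... | no  f0≮g0 =
  let j , fj<gj = ∑-<⇒∃< (f ∘ Fin.suc) (g ∘ Fin.suc)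
                    (+-cancelˡ-< (f Fin.zero) _ _ (<-≤-trans ∑f<∑g (+-monoˡ-≤ _ (≮⇒≥ f0≮g0))))
  in Fin.suc j , fj<gj

∑-pos⇒∃pos : ∀ {n} (f : Fin n → ℕ) → 0 < ∑[ i < n ] f i → ∃ λ j → 0 < f j
∑-pos⇒∃pos {n} f 0<∑f = ∑-<⇒∃< (λ _ → 0) f (subst (_< ∑[ i < n ] f i) (sym (∑-const-0 n)) 0<∑f)

f≤∑f : ∀ {n} (f : Fin n → ℕ) j → f j ≤ ∑[ i < n ] f i
f≤∑f {suc n} f Fin.zero    = m≤m+n _ _
f≤∑f {suc n} f (Fin.suc j) = ≤-trans (f≤∑f (f ∘ Fin.suc) j) (m≤n+m _ _)

∑-const-1 : ∀ n → ∑[ i < n ] 1 ≡ n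
∑-const-1 zero    = refl
∑-const-1 (suc n) = cong suc (∑-const-1 n)

∑-𝟙≥n⇒all : ∀ {n p} {P : Fin n → Set p} (P? : ∀ i → Dec (P i)) →
            n ≤ ∑[ i < n ] 𝟙 (P? i) → ∀ i → P i
∑-𝟙≥n⇒all {n} P? n≤∑ i with P? i in eq
... | yes Pi = Pi
... | no ¬Pi = ⊥-elim (<⇒≱ ∑<n n≤∑)
  where
  ∑<n : ∑[ j < n ] 𝟙 (P? j) < n
  ∑<n = subst (∑[ j < n ] 𝟙 (P? j) <_) (∑-const-1 n)
          (∑-mono-< {g = λ _ → 1} (λ j → 𝟙≤1 (P? j)) i (subst (λ d → 𝟙 d < 1) (sym eq) (s≤s z≤n)))

∑-𝟙-toℕ< : ∀ {n} k → k ≤ n → ∑[ i < n ] 𝟙 (toℕ i <? k) ≡ k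
∑-𝟙-toℕ< {zero}  zero    _         = refl
∑-𝟙-toℕ< {suc n} zero    _         = ∑-𝟙-toℕ< {n} zero z≤n
∑-𝟙-toℕ< {suc n} (suc k) (s≤s k≤n) = cong suc (trans
  (∑-cong {n} (λ i → 𝟙-cong (suc (toℕ i) <? suc k) (toℕ i <? k) ≤-pred s≤s))
  (∑-𝟙-toℕ< k k≤n))

∑-𝟙-≡toℕ : ∀ K h → ∑[ j < K ] 𝟙 (h ≟ toℕ j) ≡ 𝟙 (h <? K)
∑-𝟙-≡toℕ zero    h       = sym (𝟙-no (h <? 0) λ ())
∑-𝟙-≡toℕ (suc K) zero    = cong suc (∑-𝟙-toℕ< {K} 0 z≤n)
∑-𝟙-≡toℕ (suc K) (suc h) = trans
  (∑-cong {K} (λ j → 𝟙-cong (suc h ≟ suc (toℕ j)) (h ≟ toℕ j) suc-injective (cong suc)))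
  (trans (∑-𝟙-≡toℕ K h) (𝟙-cong (h <? K) (suc h <? suc K) s≤s ≤-pred))

∑-𝟙-≡suc : ∀ K {a} → 1 ≤ a → ∑[ j < K ] 𝟙 (a ≟ suc (toℕ j)) ≡ 𝟙 (a ≤? K)
∑-𝟙-≡suc K {suc h} _ = trans (∑-𝟙-≡toℕ (suc K) (suc h)) (sym (𝟙-cong (h <? K) (suc h <? suc K) s≤s ≤-pred))

𝟙-<-suc : ∀ a k → 𝟙 (a <? suc k) ≡ 𝟙 (a <? k) + 𝟙 (a ≟ k)
𝟙-<-suc a k with a ≟ k
... | yes refl = trans (𝟙-yes (a <? suc a) ≤-refl) (cong (_+ 1) (sym (𝟙-no (a <? a) (<-irrefl refl))))
... | no a≢k   = trans (𝟙-cong (a <? suc k) (a <? k) (λ a<1+k → ≤∧≢⇒< (≤-pred a<1+k) a≢k) m<n⇒m<1+n)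
                       (sym (+-identityʳ _))

∑-select : ∀ {n} (f : Fin n → ℕ) x → ∑[ y < n ] (𝟙 (toℕ y ≟ toℕ x) * f y) ≡ f x
∑-select {suc n} f Fin.zero = begin
  f Fin.zero + 0 + ∑[ y < n ] (𝟙 (suc (toℕ y) ≟ 0) * f (Fin.suc y)) ≡⟨ cong₂ _+_ (+-identityʳ _) (∑-const-0 n) ⟩
  f Fin.zero + 0                                                    ≡⟨ +-identityʳ _ ⟩
  f Fin.zero                                                        ∎
  where open ≡-Reasoning
∑-select {suc n} f (Fin.suc x) = trans
  (∑-cong {n} (λ y → cong (_* f (Fin.suc y))
    (𝟙-cong (suc (toℕ y) ≟ suc (toℕ x)) (toℕ y ≟ toℕ x) suc-injective (cong suc))))
  (∑-select (f ∘ Fin.suc) x)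

count≡∑𝟙 : ∀ {n a p} {A : Set a} {P : A → Set p} (P? : ∀ x → Dec (P x)) (v : Vec A n) →
           count P? v ≡ ∑[ i < n ] 𝟙 (P? (lookup v i))
count≡∑𝟙 P? []      = refl
count≡∑𝟙 P? (x ∷ v) with P? x
... | yes _ = cong suc (count≡∑𝟙 P? v)
... | no _  = count≡∑𝟙 P? v

-- Fibres, prefix counts and level sets

fibreSize : ∀ {n} → (Fin n → ℕ) → ℕ → ℕ
fibreSize {n} f v = ∑[ x < n ] 𝟙 (f x ≟ v)

countBelow : ∀ {n} → ℕ → (Fin n → ℕ) → ℕ → ℕ
countBelow {n} k f v = ∑[ y < n ] (𝟙 (toℕ y <? k) * 𝟙 (f y ≟ v))

module _ {n : ℕ} where

  fibreSize-pos⇒∃ : ∀ (f : Fin n → ℕ) v → 0 < fibreSize f v → ∃ λ x → f x ≡ v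
  fibreSize-pos⇒∃ f v 0<size =
    let x , 0<𝟙 = ∑-pos⇒∃pos (λ x → 𝟙 (f x ≟ v)) 0<size in x , 𝟙-pos (f x ≟ v) 0<𝟙

  fibreSize-pos : ∀ (f : Fin n → ℕ) x → 0 < fibreSize f (f x)
  fibreSize-pos f x = subst (_≤ fibreSize f (f x)) (𝟙-yes (f x ≟ f x) refl) (f≤∑f _ x)

  countBelow-cong : ∀ {f g : Fin n → ℕ} k → (∀ y → toℕ y < k → f y ≡ g y) →
                    ∀ v → countBelow k f v ≡ countBelow k g v
  countBelow-cong {f} {g} k f≡g v = ∑-cong agree
    where
    agree : ∀ y → 𝟙 (toℕ y <? k) * 𝟙 (f y ≟ v) ≡ 𝟙 (toℕ y <? k) * 𝟙 (g y ≟ v)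
    agree y with toℕ y <? k
    ... | yes y<k = cong (λ u → 1 * 𝟙 (u ≟ v)) (f≡g y y<k)
    ... | no _    = refl

  countBelow-all : ∀ (f : Fin n → ℕ) v → countBelow n f v ≡ fibreSize f v
  countBelow-all f v = ∑-cong λ y → trans (cong (_* 𝟙 (f y ≟ v)) (𝟙-yes (toℕ y <? n) (toℕ<n y))) (+-identityʳ _)

countBelow<fibreSize : ∀ {n} (f : Fin n → ℕ) {x y : Fin n} → toℕ x ≤ toℕ y →
                       countBelow (toℕ x) f (f y) < fibreSize f (f y)
countBelow<fibreSize {n} f {x} {y} x≤y = ∑-mono-< {n}
  (λ z → ≤-trans (*-monoˡ-≤ _ (𝟙≤1 (toℕ z <? toℕ x))) (≤-reflexive (*-identityˡ _))) y
  (subst₂ _<_ (sym (cong (_* 𝟙 (f y ≟ f y)) (𝟙-no (toℕ y <? toℕ x) (≤⇒≯ x≤y))))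
              (sym (𝟙-yes (f y ≟ f y) refl)) (s≤s z≤n))

countBelow-suc : ∀ {n} (f : Fin n → ℕ) x v →
                 countBelow (suc (toℕ x)) f v ≡ countBelow (toℕ x) f v + 𝟙 (f x ≟ v)
countBelow-suc {n} f x v = begin
  ∑[ y < n ] (𝟙 (toℕ y <? suc (toℕ x)) * 𝟙 (f y ≟ v))
    ≡⟨ ∑-cong {n} (λ y → trans (cong (_* 𝟙 (f y ≟ v)) (𝟙-<-suc (toℕ y) (toℕ x))) (*-distribʳ-+ (𝟙 (f y ≟ v)) (𝟙 (toℕ y <? toℕ x)) _)) ⟩
  ∑[ y < n ] (𝟙 (toℕ y <? toℕ x) * 𝟙 (f y ≟ v) + 𝟙 (toℕ y ≟ toℕ x) * 𝟙 (f y ≟ v))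
    ≡⟨ ∑-distrib-+ (λ y → 𝟙 (toℕ y <? toℕ x) * 𝟙 (f y ≟ v)) (λ y → 𝟙 (toℕ y ≟ toℕ x) * 𝟙 (f y ≟ v)) ⟩
  countBelow (toℕ x) f v + ∑[ y < n ] (𝟙 (toℕ y ≟ toℕ x) * 𝟙 (f y ≟ v))
    ≡⟨ cong (countBelow (toℕ x) f v +_) (∑-select (λ y → 𝟙 (f y ≟ v)) x) ⟩
  countBelow (toℕ x) f v + 𝟙 (f x ≟ v) ∎
  where open ≡-Reasoning

countBelow-fresh : ∀ {n} {f : Fin n → ℕ} → (∀ y → f y ≤ suc (toℕ y)) → ∀ k → countBelow k f (suc k) ≡ 0
countBelow-fresh {n} {f} f≤suc k = trans (∑-cong {n} none) (∑-const-0 n)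
  where
  none : ∀ y → 𝟙 (toℕ y <? k) * 𝟙 (f y ≟ suc k) ≡ 0
  none y with toℕ y <? k
  ... | no _    = refl
  ... | yes y<k = trans (+-identityʳ _) (𝟙-no (f y ≟ suc k) λ fy≡1+k →
                    <-irrefl refl (≤-trans (subst (_≤ suc (toℕ y)) fy≡1+k (f≤suc y)) y<k))

∑-countBelow : ∀ {n} {f : Fin n → ℕ} → (∀ y → 1 ≤ f y) → (∀ y → f y ≤ suc (toℕ y)) →
               ∀ k → k ≤ n → ∑[ j < k ] countBelow k f (suc (toℕ j)) ≡ k
∑-countBelow {n} {f} 1≤f f≤suc k k≤n = begin
  ∑[ j < k ] ∑[ y < n ] (𝟙 (toℕ y <? k) * 𝟙 (f y ≟ suc (toℕ j)))  ≡⟨ ∑-comm {k} {n} (λ j y → 𝟙 (toℕ y <? k) * 𝟙 (f y ≟ suc (toℕ j))) ⟩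
  ∑[ y < n ] ∑[ j < k ] (𝟙 (toℕ y <? k) * 𝟙 (f y ≟ suc (toℕ j)))  ≡⟨ ∑-cong {n} (λ y → *-distribˡ-sum {k} (𝟙 (toℕ y <? k)) (λ j → 𝟙 (f y ≟ suc (toℕ j)))) ⟨
  ∑[ y < n ] (𝟙 (toℕ y <? k) * ∑[ j < k ] 𝟙 (f y ≟ suc (toℕ j)))  ≡⟨ ∑-cong {n} (λ y → cong (𝟙 (toℕ y <? k) *_) (∑-𝟙-≡suc k (1≤f y))) ⟩
  ∑[ y < n ] (𝟙 (toℕ y <? k) * 𝟙 (f y ≤? k))                      ≡⟨ ∑-cong {n} below ⟩
  ∑[ y < n ] 𝟙 (toℕ y <? k)                                        ≡⟨ ∑-𝟙-toℕ< k k≤n ⟩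
  k                                                                ∎
  where
  open ≡-Reasoning
  below : ∀ y → 𝟙 (toℕ y <? k) * 𝟙 (f y ≤? k) ≡ 𝟙 (toℕ y <? k)
  below y with toℕ y <? k
  ... | yes y<k = trans (+-identityʳ _) (𝟙-yes (f y ≤? k) (≤-trans (f≤suc y) y<k))
  ... | no _    = refl

minElt≤ : ∀ {n} {B : Subset n} {x} → x ∈ B → minElt B ≤ suc (toℕ x)
minElt≤ {B = true  ∷ _} _           = s≤s z≤n
minElt≤ {B = false ∷ _} (there x∈B) = s≤s (minElt≤ x∈B)

minElt-∈ : ∀ {n} {B : Subset n} {x} → x ∈ B → ∃ λ e → e ∈ B × suc (toℕ e) ≡ minElt B
minElt-∈ {B = true  ∷ _} _ = Fin.zero , here , refl
minElt-∈ {B = false ∷ _} (there x∈B) =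
  let e , e∈B , e+1≡min = minElt-∈ x∈B in Fin.suc e , there e∈B , cong suc e+1≡min

minElt-least : ∀ {n} {B : Subset n} {e} → e ∈ B → (∀ {y} → y ∈ B → toℕ e ≤ toℕ y) →
               minElt B ≡ suc (toℕ e)
minElt-least e∈B e≤ =
  let e′ , e′∈B , e′+1≡min = minElt-∈ e∈B
  in ≤-antisym (minElt≤ e∈B) (subst (suc _ ≤_) e′+1≡min (s≤s (e≤ e′∈B)))

levelSet : ∀ {n} → (Fin n → ℕ) → ℕ → Subset n
levelSet f v = tabulate (λ x → does (f x ≟ v))

module _ {n} (f : Fin n → ℕ) {v : ℕ} where

  ∈-levelSet⁺ : ∀ {x} → f x ≡ v → x ∈ levelSet f v
  ∈-levelSet⁺ {x} fx≡v = lookup⇒[]= x _ (trans (lookup∘tabulate _ x) (dec-true (f x ≟ v) fx≡v))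

  ∈-levelSet⁻ : ∀ {x} → x ∈ levelSet f v → f x ≡ v
  ∈-levelSet⁻ {x} x∈ with f x ≟ v in eq
  ... | yes fx≡v = fx≡v
  ... | no _     = ⊥-elim (false≢true (trans (sym (trans (lookup∘tabulate _ x) (cong does eq))) ([]=⇒lookup x∈)))
    where
    false≢true : false ≡ true → ⊥
    false≢true ()

∣∣≡∑𝟙∈ : ∀ {n} (B : Subset n) → ∣ B ∣ ≡ ∑[ x < n ] 𝟙 (x ∈? B)
∣∣≡∑𝟙∈ {n} B = trans (count≡∑𝟙 (_≟ᵇ true) B)
  (∑-cong {n} λ x → 𝟙-cong (lookup B x ≟ᵇ true) (x ∈? B) (lookup⇒[]= x B) []=⇒lookup)

∣levelSet∣ : ∀ {n} (f : Fin n → ℕ) v → ∣ levelSet f v ∣ ≡ fibreSize f v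
∣levelSet∣ {n} f v = trans (count≡∑𝟙 (_≟ᵇ true) (levelSet f v))
  (∑-cong {n} λ x → trans (cong (λ b → 𝟙 (b ≟ᵇ true)) (lookup∘tabulate _ x)) (𝟙-does (f x ≟ v)))

levelSet-cong : ∀ {n} {f g : Fin n → ℕ} → (∀ x → f x ≡ g x) → ∀ v → levelSet f v ≡ levelSet g v
levelSet-cong f≗g v = tabulate-cong (λ x → cong (λ u → does (u ≟ v)) (f≗g x))

levelSet-disjoint : ∀ {n} (f : Fin n → ℕ) {u v} → u ≢ v → Disjoint (levelSet f u) (levelSet f v)
levelSet-disjoint f u≢v (x , x∈∩) =
  let x∈u , x∈v = x∈p∩q⁻ _ _ x∈∩ in u≢v (trans (sym (∈-levelSet⁻ f x∈u)) (∈-levelSet⁻ f x∈v))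

-- Block-minimum functions

-- f x is the least element of the block of x in a noncrossing partition, numbered from 1
-- (point x : Fin n is the element toℕ x + 1); `attained` says that it lies in that block.
record IsBlockMinima {n} (f : Fin n → ℕ) : Set where
  field
    ≤suc        : ∀ x → f x ≤ suc (toℕ x)
    attained    : ∀ x → ∃ λ e → f e ≡ f x × suc (toℕ e) ≡ f x
    nonCrossing : ∀ {a b c d} → a Fin.< b → b Fin.< c → c Fin.< d →
                  f a ≡ f c → f b ≡ f d → f a ≡ f b

  opens : ∀ x → 0 < fibreSize f (suc (toℕ x)) → f x ≡ suc (toℕ x)
  opens x 0<size =
    let y , fy≡x+1 = fibreSize-pos⇒∃ f _ 0<size
        e , fe≡fy , e+1≡fy = attained y
        e≡x = toℕ-injective (suc-injective (trans e+1≡fy fy≡x+1))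
    in subst (λ z → f z ≡ suc (toℕ x)) e≡x (trans fe≡fy fy≡x+1)

  -- An element of block v after x would cross the block of x.
  closedBefore : ∀ x {v} → f x < v → v ≤ toℕ x → countBelow (toℕ x) f v ≡ fibreSize f v
  closedBefore x {v} fx<v v≤x = ∑-cong {n} before
    where
    before : ∀ y → 𝟙 (toℕ y <? toℕ x) * 𝟙 (f y ≟ v) ≡ 𝟙 (f y ≟ v)
    before y with f y ≟ v
    ... | no _ = *-zeroʳ (𝟙 (toℕ y <? toℕ x))
    ... | yes fy≡v with toℕ y <? toℕ x
    ...   | yes _  = refl
    ...   | no y≮x with m≤n⇒m<n∨m≡n (≮⇒≥ y≮x)
    ...     | inj₂ x≡y = ⊥-elim (<⇒≢ fx<v (trans (cong f (toℕ-injective x≡y)) fy≡v))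
    ...     | inj₁ x<y =
      let a , fa≡fx , a+1≡fx = attained x
          b , fb≡fy , b+1≡fy = attained y
          a<b = ≤-pred (subst₂ _<_ (sym a+1≡fx) (sym (trans b+1≡fy fy≡v)) fx<v)
          b<x = subst (_≤ toℕ x) (sym (trans b+1≡fy fy≡v)) v≤x
          fx≡v = trans (sym fa≡fx) (trans (nonCrossing a<b b<x x<y fa≡fx fb≡fy) (trans fb≡fy fy≡v))
      in ⊥-elim (<⇒≢ fx<v fx≡v)

open IsBlockMinima

-- If f x < g x = v ≤ x, then by noncrossing the f-block with minimum v ends before x,
-- while the g-block with minimum v still contains x: the counts below x differ.
blockMinima-≮ : ∀ {n} {f g : Fin n → ℕ} → IsBlockMinima f → IsBlockMinima g →
                (∀ v → fibreSize f v ≡ fibreSize g v) →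
                ∀ x → (∀ y → toℕ y < toℕ x → f y ≡ g y) → ¬ f x < g x
blockMinima-≮ {f = f} {g} bmf bmg sizes x f≡g-below fx<gx with g x ≟ suc (toℕ x)
... | yes gx≡x+1 = <⇒≢ fx<gx (trans (opens bmf x (subst (0 <_) (sym (sizes _)) 0<size)) (sym gx≡x+1))
  where
  0<size : 0 < fibreSize g (suc (toℕ x))
  0<size = subst (λ v → 0 < fibreSize g v) gx≡x+1 (fibreSize-pos g x)
... | no gx≢x+1 = <-irrefl refl (begin-strict
  fibreSize f v              ≡⟨ closedBefore bmf x fx<gx (≤-pred (≤∧≢⇒< (≤suc bmg x) gx≢x+1)) ⟨
  countBelow (toℕ x) f v     ≡⟨ countBelow-cong (toℕ x) f≡g-below v ⟩
  countBelow (toℕ x) g v     <⟨ countBelow<fibreSize g {x} ≤-refl ⟩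
  fibreSize g v              ≡⟨ sizes v ⟨
  fibreSize f v              ∎)
  where
  open ≤-Reasoning
  v = g x

blockMinima-unique : ∀ {n} {f g : Fin n → ℕ} → IsBlockMinima f → IsBlockMinima g →
                     (∀ v → fibreSize f v ≡ fibreSize g v) → ∀ x → f x ≡ g x
blockMinima-unique {f = f} {g} bmf bmg sizes x = agreeBelow (suc (toℕ x)) x ≤-refl
  where
  agreeAt : ∀ y → (∀ z → toℕ z < toℕ y → f z ≡ g z) → f y ≡ g y
  agreeAt y f≡g-below with <-cmp (f y) (g y)
  ... | tri≈ _ fy≡gy _ = fy≡gy
  ... | tri< fy<gy _ _ = ⊥-elim (blockMinima-≮ bmf bmg sizes y f≡g-below fy<gy)
  ... | tri> _ _ gy<fy = ⊥-elim (blockMinima-≮ bmg bmf (sym ∘ sizes) y (λ z z<y → sym (f≡g-below z z<y)) gy<fy)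

  agreeBelow : ∀ k y → toℕ y < k → f y ≡ g y
  agreeBelow (suc k) y y<1+k with m≤n⇒m<n∨m≡n (≤-pred y<1+k)
  ... | inj₁ y<k = agreeBelow k y y<k
  ... | inj₂ y≡k = agreeAt y (λ z z<y → agreeBelow k z (subst (toℕ z <_) y≡k z<y))

minElt-levelSet : ∀ {n} {f : Fin n → ℕ} → IsBlockMinima f → ∀ x → minElt (levelSet f (f x)) ≡ f x
minElt-levelSet {f = f} bm x =
  let e , fe≡fx , e+1≡fx = attained bm x
      e≤ : ∀ {y} → y ∈ levelSet f (f x) → toℕ e ≤ toℕ y
      e≤ y∈ = ≤-pred (subst (_≤ suc _) (trans (∈-levelSet⁻ f y∈) (sym e+1≡fx)) (≤suc bm _))
  in trans (minElt-least (∈-levelSet⁺ f fe≡fx) e≤) e+1≡fx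

levelSet-noCrossing : ∀ {n} {f : Fin n → ℕ} → IsBlockMinima f → ∀ {u v} → u ≢ v →
                      NoCrossing (levelSet f u) (levelSet f v)
levelSet-noCrossing {f = f} bm u≢v a b c d a<b b<c c<d a∈ c∈ b∈ d∈ = u≢v (begin
  _ ≡⟨ ∈-levelSet⁻ f a∈ ⟨
  _ ≡⟨ nonCrossing bm a<b b<c c<d (trans (∈-levelSet⁻ f a∈) (sym (∈-levelSet⁻ f c∈)))
                                  (trans (∈-levelSet⁻ f b∈) (sym (∈-levelSet⁻ f d∈))) ⟩
  _ ≡⟨ ∈-levelSet⁻ f b∈ ⟩
  _ ∎)
  where open ≡-Reasoning

levelSets-isSetPartition : ∀ {n} (f : Fin n → ℕ) {vs : List ℕ} → AllPairs _≢_ vs →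
                           All (λ v → 0 < fibreSize f v) vs → (∀ x → f x ∈ₗ vs) →
                           IsSetPartition (List.map (levelSet f) vs)
levelSets-isSetPartition f distinct occupied covered =
  AllP.map⁺ (All.map (λ {v} 0<size → let x , fx≡v = fibreSize-pos⇒∃ f v 0<size in x , ∈-levelSet⁺ f fx≡v) occupied) ,
  AllPairsP.map⁺ (AllPairs.map (levelSet-disjoint f) distinct) ,
  λ x → AnyP.map⁺ (lose (covered x) (∈-levelSet⁺ f refl))

-- Partitions given by a labelling

AllPairs-∈ : ∀ {a r} {A : Set a} {R : A → A → Set r} {xs : List A} {x y} →
             AllPairs R xs → x ∈ₗ xs → y ∈ₗ xs → x ≡ y ⊎ R x y ⊎ R y x
AllPairs-∈ (_   ∷ _)   (here refl) (here refl) = inj₁ refl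
AllPairs-∈ (Rx ∷ _)    (here refl) (there y∈)  = inj₂ (inj₁ (All.lookup Rx y∈))
AllPairs-∈ (Rx ∷ _)    (there x∈)  (here refl) = inj₂ (inj₂ (All.lookup Rx x∈))
AllPairs-∈ (_  ∷ Rxs)  (there x∈)  (there y∈)  = AllPairs-∈ Rxs x∈ y∈

∑-sumₗ-comm : ∀ {n} {A : Set} (F : Fin n → A → ℕ) (s : List A) →
              ∑[ x < n ] sumₗ (List.map (F x) s) ≡ sumₗ (List.map (λ p → ∑[ x < n ] F x p) s)
∑-sumₗ-comm {n} F []      = ∑-const-0 n
∑-sumₗ-comm {n} F (p ∷ s) =
  trans (∑-distrib-+ (λ x → F x p) (λ x → sumₗ (List.map (F x) s))) (cong (_ +_) (∑-sumₗ-comm F s))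

record IsPartitionBy {A : Set} {n} (sel : A → Subset n) (t : List A) : Set where
  field
    nonempty : All (Nonempty ∘ sel) t
    disjoint : AllPairs (Disjoint on sel) t
    covers   : ∀ x → Any ((x ∈_) ∘ sel) t

  blockOf : Fin n → A
  blockOf x = proj₁ (find (covers x))

  blockOf-∈ : ∀ x → blockOf x ∈ₗ t
  blockOf-∈ x = proj₁ (proj₂ (find (covers x)))

  ∈-blockOf : ∀ x → x ∈ sel (blockOf x)
  ∈-blockOf x = proj₂ (proj₂ (find (covers x)))

  block-unique : ∀ {p q x} → p ∈ₗ t → q ∈ₗ t → x ∈ sel p → x ∈ sel q → p ≡ q
  block-unique p∈t q∈t x∈p x∈q with AllPairs-∈ disjoint p∈t q∈t
  ... | inj₁ p≡q        = p≡q
  ... | inj₂ (inj₁ p#q) = ⊥-elim (p#q (_ , x∈p∩q⁺ (x∈p , x∈q)))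
  ... | inj₂ (inj₂ q#p) = ⊥-elim (q#p (_ , x∈p∩q⁺ (x∈q , x∈p)))

  blockOf-unique : ∀ {p x} → p ∈ₗ t → x ∈ sel p → blockOf x ≡ p
  blockOf-unique p∈t x∈p = block-unique (blockOf-∈ _) p∈t (∈-blockOf _) x∈p

  minElt-injective : ∀ {p q} → p ∈ₗ t → q ∈ₗ t → minElt (sel p) ≡ minElt (sel q) → p ≡ q
  minElt-injective {p} {q} p∈t q∈t min≡ =
    let e , e∈p , e+1≡minp = minElt-∈ (proj₂ (All.lookup nonempty p∈t))
        e′ , e′∈q , e′+1≡minq = minElt-∈ (proj₂ (All.lookup nonempty q∈t))
        e≡e′ = toℕ-injective (suc-injective (trans e+1≡minp (trans min≡ (sym e′+1≡minq))))
    in block-unique p∈t q∈t e∈p (subst (_∈ sel q) (sym e≡e′) e′∈q)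

  distinct : Unique t
  distinct = go disjoint nonempty
    where
    go : ∀ {s} → AllPairs (Disjoint on sel) s → All (Nonempty ∘ sel) s → AllPairs _≢_ s
    go []           []                = []
    go (p#s ∷ #s)  ((x , x∈p) ∷ nes) =
      All.map (λ p#q p≡q → p#q (x , x∈p∩q⁺ (x∈p , subst (λ r → x ∈ sel r) p≡q x∈p))) p#s ∷ go #s nes

  sumₗ-select-block : ∀ (h : A → ℕ) {p x} → p ∈ₗ t → x ∈ sel p →
              sumₗ (List.map (λ q → 𝟙 (x ∈? sel q) * h q) t) ≡ h p
  sumₗ-select-block h = go disjoint
    where
    outside : ∀ {x s} → All (λ q → x ∉ sel q) s → sumₗ (List.map (λ q → 𝟙 (x ∈? sel q) * h q) s) ≡ 0
    outside []           = refl
    outside {x} {q ∷ _} (x∉q ∷ x∉s) = cong₂ _+_ (cong (_* h q) (𝟙-no (x ∈? sel q) x∉q)) (outside x∉s)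
    go : ∀ {s p x} → AllPairs (Disjoint on sel) s → p ∈ₗ s → x ∈ sel p →
         sumₗ (List.map (λ q → 𝟙 (x ∈? sel q) * h q) s) ≡ h p
    go {p ∷ _} {x = x} (p#s ∷ _) (here refl) x∈p = begin
      𝟙 (x ∈? sel p) * h p + _ ≡⟨ cong₂ _+_ (cong (_* h p) (𝟙-yes (x ∈? sel p) x∈p))
                                           (outside (All.map (λ p#q x∈q → p#q (x , x∈p∩q⁺ (x∈p , x∈q))) p#s)) ⟩
      1 * h p + 0              ≡⟨ +-identityʳ _ ⟩
      1 * h p                  ≡⟨ *-identityˡ _ ⟩
      h p                      ∎
      where open ≡-Reasoning
    go {q ∷ _} {x = x} (q#s ∷ #s) (there p∈s) x∈p =
      cong₂ _+_ (cong (_* h q) (𝟙-no (x ∈? sel q) λ x∈q → All.lookup q#s p∈s (x , x∈p∩q⁺ (x∈q , x∈p))))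
                (go #s p∈s x∈p)

  ∑-blockOf : ∀ (h : A → ℕ) → ∑[ x < n ] h (blockOf x) ≡ sumₗ (List.map (λ p → h p * ∣ sel p ∣) t)
  ∑-blockOf h = begin
    ∑[ x < n ] h (blockOf x)                                  ≡⟨ ∑-cong {n} (λ x → sumₗ-select-block h (blockOf-∈ x) (∈-blockOf x)) ⟨
    ∑[ x < n ] sumₗ (List.map (λ q → 𝟙 (x ∈? sel q) * h q) t)  ≡⟨ ∑-sumₗ-comm (λ x q → 𝟙 (x ∈? sel q) * h q) t ⟩
    sumₗ (List.map (λ q → ∑[ x < n ] (𝟙 (x ∈? sel q) * h q)) t) ≡⟨ cong sumₗ (ListP.map-cong weight t) ⟩
    sumₗ (List.map (λ p → h p * ∣ sel p ∣) t)                  ∎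
    where
    open ≡-Reasoning
    weight : ∀ q → ∑[ x < n ] (𝟙 (x ∈? sel q) * h q) ≡ h q * ∣ sel q ∣
    weight q = begin
      ∑[ x < n ] (𝟙 (x ∈? sel q) * h q)  ≡⟨ ∑-cong {n} (λ x → *-comm (𝟙 (x ∈? sel q)) (h q)) ⟩
      ∑[ x < n ] (h q * 𝟙 (x ∈? sel q))  ≡⟨ *-distribˡ-sum (h q) (λ x → 𝟙 (x ∈? sel q)) ⟨
      h q * ∑[ x < n ] 𝟙 (x ∈? sel q)    ≡⟨ cong (h q *_) (∣∣≡∑𝟙∈ (sel q)) ⟨
      h q * ∣ sel q ∣                    ∎

isPartitionBy : ∀ {A : Set} {n} {sel : A → Subset n} {t : List A} →
                IsSetPartition (List.map sel t) → IsPartitionBy sel t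
isPartitionBy (nonempty , disjoint , covers) = record
  { nonempty = AllP.map⁻ nonempty
  ; disjoint = AllPairsP.map⁻ disjoint
  ; covers   = λ x → AnyP.map⁻ (covers x)
  }

-- The map from Π² to words

letterAt-∈ : ∀ {n} {t : Triple n} {p i} → AllPairs (Disjoint on proj₂) t →
             p ∈ₗ t → i ∈ proj₂ p → letterAt t i ≡ minElt (proj₁ p)
letterAt-∈ {i = i} (_ ∷ _) (here refl) i∈C rewrite dec-true (i ∈? _) i∈C = refl
letterAt-∈ {t = (B , C) ∷ _} {i = i} (C#t ∷ #t) (there p∈t) i∈p
  rewrite dec-false (i ∈? C) (λ i∈C → All.lookup C#t p∈t (i , x∈p∩q⁺ (i∈C , i∈p))) = letterAt-∈ #t p∈t i∈p

lookup-toWord : ∀ {n} (t : Triple n) i → lookup (toWord t) i ≡ letterAt t i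
lookup-toWord t = lookup∘tabulate (letterAt t)

module Π² {n} {t : Triple n} (H : InΠ² t) where

  private
    module B = IsPartitionBy (isPartitionBy {sel = proj₁} (proj₁ (proj₁ H)))
    module C = IsPartitionBy (isPartitionBy {sel = proj₂} (proj₁ (proj₂ H)))

  blockMin : Fin n → ℕ
  blockMin x = minElt (proj₁ (B.blockOf x))

  blockMin-∈ : ∀ {p x} → p ∈ₗ t → x ∈ proj₁ p → blockMin x ≡ minElt (proj₁ p)
  blockMin-∈ p∈t x∈p = cong (minElt ∘ proj₁) (B.blockOf-unique p∈t x∈p)

  letterAt-blockOf : ∀ i → letterAt t i ≡ minElt (proj₁ (C.blockOf i))
  letterAt-blockOf i = letterAt-∈ C.disjoint (C.blockOf-∈ i) (C.∈-blockOf i)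

  blockMin-isBlockMinima : IsBlockMinima blockMin
  blockMin-isBlockMinima = record
    { ≤suc        = λ x → minElt≤ (B.∈-blockOf x)
    ; attained    = λ x → let e , e∈ , e+1≡ = minElt-∈ (B.∈-blockOf x)
                          in e , blockMin-∈ (B.blockOf-∈ x) e∈ , e+1≡
    ; nonCrossing = nonCrossing′
    }
    where
    sameBlock : ∀ {x y} → blockMin x ≡ blockMin y → y ∈ proj₁ (B.blockOf x)
    sameBlock {x} {y} bx≡by =
      subst (λ p → y ∈ proj₁ p) (B.minElt-injective (B.blockOf-∈ y) (B.blockOf-∈ x) (sym bx≡by)) (B.∈-blockOf y)
    nonCrossing′ : ∀ {a b c d} → a Fin.< b → b Fin.< c → c Fin.< d →
                   blockMin a ≡ blockMin c → blockMin b ≡ blockMin d → blockMin a ≡ blockMin b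
    nonCrossing′ {a} {b} {c} {d} a<b b<c c<d ba≡bc bb≡bd
      with AllPairs-∈ (AllPairsP.map⁻ (proj₂ (proj₁ H))) (B.blockOf-∈ a) (B.blockOf-∈ b)
    ... | inj₁ p≡q = cong (minElt ∘ proj₁) p≡q
    ... | inj₂ (inj₁ p⋈q) = ⊥-elim (proj₁ p⋈q a b c d a<b b<c c<d (B.∈-blockOf a) (sameBlock ba≡bc) (B.∈-blockOf b) (sameBlock bb≡bd))
    ... | inj₂ (inj₂ q⋈p) = ⊥-elim (proj₂ q⋈p a b c d a<b b<c c<d (B.∈-blockOf a) (sameBlock ba≡bc) (B.∈-blockOf b) (sameBlock bb≡bd))

  letters-equidistributed : ∀ (φ : ℕ → ℕ) → ∑[ i < n ] φ (letterAt t i) ≡ ∑[ x < n ] φ (blockMin x)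
  letters-equidistributed φ = begin
    ∑[ i < n ] φ (letterAt t i)                              ≡⟨ ∑-cong {n} (cong φ ∘ letterAt-blockOf) ⟩
    ∑[ i < n ] φ (minElt (proj₁ (C.blockOf i)))               ≡⟨ C.∑-blockOf (φ ∘ minElt ∘ proj₁) ⟩
    sumₗ (List.map (λ p → φ (minElt (proj₁ p)) * ∣ proj₂ p ∣) t) ≡⟨ cong sumₗ (ListP.map-cong-local sameSize) ⟩
    sumₗ (List.map (λ p → φ (minElt (proj₁ p)) * ∣ proj₁ p ∣) t) ≡⟨ B.∑-blockOf (φ ∘ minElt ∘ proj₁) ⟨
    ∑[ x < n ] φ (blockMin x)                                 ∎
    where
    open ≡-Reasoning
    sameSize : All (λ p → φ (minElt (proj₁ p)) * ∣ proj₂ p ∣ ≡ φ (minElt (proj₁ p)) * ∣ proj₁ p ∣) t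
    sameSize = All.map (λ {p} → cong (φ (minElt (proj₁ p)) *_) ∘ sym) (proj₂ (proj₂ H))

  isParkingFunction : IsParkingFunction (toWord t)
  isParkingFunction = positive , enoughSmall
    where
    positive : ∀ i → 1 ≤ lookup (toWord t) i
    positive i = let _ , _ , e+1≡min = minElt-∈ (proj₂ (All.lookup B.nonempty (C.blockOf-∈ i))) in
      subst (1 ≤_) (sym (trans (lookup-toWord t i) (trans (letterAt-blockOf i) (sym e+1≡min)))) (s≤s z≤n)
    enoughSmall : ∀ k → 1 ≤ k → k ≤ n → k ≤ count (_≤? k) (toWord t)
    enoughSmall k _ k≤n = begin
      k                                            ≡⟨ ∑-𝟙-toℕ< k k≤n ⟨
      ∑[ x < n ] 𝟙 (toℕ x <? k)                    ≤⟨ ∑-mono-≤ {n} (λ x → 𝟙-mono (toℕ x <? k) (blockMin x ≤? k)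
                                                        (≤-trans (≤suc blockMin-isBlockMinima x))) ⟩
      ∑[ x < n ] 𝟙 (blockMin x ≤? k)               ≡⟨ letters-equidistributed (λ v → 𝟙 (v ≤? k)) ⟨
      ∑[ i < n ] 𝟙 (letterAt t i ≤? k)             ≡⟨ ∑-cong {n} (λ i → cong (λ v → 𝟙 (v ≤? k)) (lookup-toWord t i)) ⟨
      ∑[ i < n ] 𝟙 (lookup (toWord t) i ≤? k)      ≡⟨ count≡∑𝟙 (_≤? k) (toWord t) ⟨
      count (_≤? k) (toWord t)                     ∎
      where open ≤-Reasoning

  fibreSize-letterAt : ∀ v → fibreSize (letterAt t) v ≡ fibreSize blockMin v
  fibreSize-letterAt v = letters-equidistributed (λ u → 𝟙 (u ≟ v))

  ≡levelSets : ∀ {p} → p ∈ₗ t →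
               p ≡ (levelSet blockMin (minElt (proj₁ p)) , levelSet (letterAt t) (minElt (proj₁ p)))
  ≡levelSets {p} p∈t = cong₂ _,_ (⊆-antisym B⊆ ⊆B) (⊆-antisym C⊆ ⊆C)
    where
    B⊆ : proj₁ p ⊆ levelSet blockMin (minElt (proj₁ p))
    B⊆ x∈p = ∈-levelSet⁺ blockMin (blockMin-∈ p∈t x∈p)
    ⊆B : levelSet blockMin (minElt (proj₁ p)) ⊆ proj₁ p
    ⊆B {x} x∈ = subst (λ q → x ∈ proj₁ q)
      (B.minElt-injective (B.blockOf-∈ x) p∈t (∈-levelSet⁻ blockMin x∈)) (B.∈-blockOf x)
    C⊆ : proj₂ p ⊆ levelSet (letterAt t) (minElt (proj₁ p))
    C⊆ i∈p = ∈-levelSet⁺ (letterAt t) (letterAt-∈ C.disjoint p∈t i∈p)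
    ⊆C : levelSet (letterAt t) (minElt (proj₁ p)) ⊆ proj₂ p
    ⊆C {i} i∈ = subst (λ q → i ∈ proj₂ q)
      (B.minElt-injective (C.blockOf-∈ i) p∈t (trans (sym (letterAt-blockOf i)) (∈-levelSet⁻ (letterAt t) i∈)))
      (C.∈-blockOf i)

  blockMin-attains : ∀ {p} → p ∈ₗ t → ∃ λ x → blockMin x ≡ minElt (proj₁ p)
  blockMin-attains p∈t = let x , x∈p = All.lookup B.nonempty p∈t in x , blockMin-∈ p∈t x∈p

  block-of-blockMin : ∀ x → ∃ λ q → q ∈ₗ t × minElt (proj₁ q) ≡ blockMin x
  block-of-blockMin x = B.blockOf x , B.blockOf-∈ x , refl

  distinct : Unique t
  distinct = B.distinct

  letterAt-≡ : ∀ {p i} → p ∈ₗ t → i ∈ proj₂ p → letterAt t i ≡ minElt (proj₁ p)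
  letterAt-≡ = letterAt-∈ C.disjoint

  block-containing : ∀ i → ∃ λ p → p ∈ₗ t × i ∈ proj₂ p
  block-containing i = C.blockOf i , C.blockOf-∈ i , C.∈-blockOf i

toWord-resp-↭ : ∀ {n} {t t′ : Triple n} → InΠ² t → InΠ² t′ → t ↭ t′ → toWord t ≡ toWord t′
toWord-resp-↭ H H′ t↭t′ = tabulate-cong λ i →
  let p , p∈t , i∈p = Π².block-containing H i
  in trans (Π².letterAt-≡ H p∈t i∈p) (sym (Π².letterAt-≡ H′ (∈-resp-↭ t↭t′ p∈t) i∈p))

-- The word fixes the fibre sizes of blockMin, hence blockMin itself, hence every pair.
toWord-≡⇒⊆ : ∀ {n} {t t′ : Triple n} → InΠ² t → InΠ² t′ → toWord t ≡ toWord t′ → ∀ {p} → p ∈ₗ t → p ∈ₗ t′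
toWord-≡⇒⊆ {n} {t} {t′} H H′ w≡w′ {p} p∈t = subst (_∈ₗ t′) (sym p≡q) q∈t′
  where
  module T  = Π² H
  module T′ = Π² H′
  letters≡ : ∀ i → letterAt t i ≡ letterAt t′ i
  letters≡ i = trans (sym (lookup-toWord t i)) (trans (cong (λ w → lookup w i) w≡w′) (lookup-toWord t′ i))
  blockMins≡ : ∀ x → T.blockMin x ≡ T′.blockMin x
  blockMins≡ = blockMinima-unique T.blockMin-isBlockMinima T′.blockMin-isBlockMinima λ v → begin
    fibreSize T.blockMin v       ≡⟨ T.fibreSize-letterAt v ⟨
    fibreSize (letterAt t) v     ≡⟨ ∑-cong {n} (λ i → cong (λ u → 𝟙 (u ≟ v)) (letters≡ i)) ⟩
    fibreSize (letterAt t′) v    ≡⟨ T′.fibreSize-letterAt v ⟩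
    fibreSize T′.blockMin v      ∎
    where open ≡-Reasoning
  x = proj₁ (T.blockMin-attains p∈t)
  q = proj₁ (T′.block-of-blockMin x)
  q∈t′ = proj₁ (proj₂ (T′.block-of-blockMin x))
  minq≡minp : minElt (proj₁ q) ≡ minElt (proj₁ p)
  minq≡minp = trans (proj₂ (proj₂ (T′.block-of-blockMin x)))
                    (trans (sym (blockMins≡ x)) (proj₂ (T.blockMin-attains p∈t)))
  p≡q : p ≡ q
  p≡q = begin
    p                                                                           ≡⟨ T.≡levelSets p∈t ⟩
    (levelSet T.blockMin (minElt (proj₁ p)) , levelSet (letterAt t) (minElt (proj₁ p)))
      ≡⟨ cong₂ _,_ (levelSet-cong blockMins≡ _) (levelSet-cong letters≡ _) ⟩
    (levelSet T′.blockMin (minElt (proj₁ p)) , levelSet (letterAt t′) (minElt (proj₁ p)))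
      ≡⟨ cong (λ v → levelSet T′.blockMin v , levelSet (letterAt t′) v) minq≡minp ⟨
    (levelSet T′.blockMin (minElt (proj₁ q)) , levelSet (letterAt t′) (minElt (proj₁ q)))
      ≡⟨ T′.≡levelSets q∈t′ ⟨
    q                                                                           ∎
    where open ≡-Reasoning

toWord-injective : ∀ {n} {t t′ : Triple n} → InΠ² t → InΠ² t′ → toWord t ≡ toWord t′ → t ↭ t′
toWord-injective H H′ w≡w′ = ∼bag⇒↭ (unique∧set⇒bag (Π².distinct H) (Π².distinct H′)
  (mk⇔ (toWord-≡⇒⊆ H H′ w≡w′) (toWord-≡⇒⊆ H′ H (sym w≡w′))))

does-∈? : ∀ {n} (x : Fin n) (B : Subset n) → does (x ∈? B) ≡ lookup B x
does-∈? Fin.zero    (true  ∷ _) = refl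
does-∈? Fin.zero    (false ∷ _) = refl
does-∈? (Fin.suc x) (_     ∷ B) = does-∈? x B

letterAt-actTriple : ∀ {n} (σ : Permutation′ n) t i → letterAt (actTriple σ t) i ≡ letterAt t (σ ⟨$⟩ˡ i)
letterAt-actTriple σ []            i = refl
letterAt-actTriple σ ((B , C) ∷ t) i
  rewrite does-∈? i (actSubset σ C) | lookup∘tabulate (λ k → lookup C (σ ⟨$⟩ˡ k)) i | sym (does-∈? (σ ⟨$⟩ˡ i) C)
  = cong (if_then_else_ (does ((σ ⟨$⟩ˡ i) ∈? C)) (minElt B)) (letterAt-actTriple σ t i)

toWord-equivariant : ∀ {n} (σ : Permutation′ n) (t : Triple n) → toWord (actTriple σ t) ≡ actWord σ (toWord t)
toWord-equivariant σ t = tabulate-cong λ i → trans (letterAt-actTriple σ t i) (sym (lookup-toWord t (σ ⟨$⟩ˡ i)))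

-- Parking functions come from Π²

module _ {p} {P : ℕ → Set p} (P? : ∀ j → Dec (P j)) where

  largestBelow : ℕ → ℕ
  largestBelow zero    = 0
  largestBelow (suc K) with P? K
  ... | yes _ = K
  ... | no _  = largestBelow K

  largestBelow≤ : ∀ K → largestBelow K ≤ K
  largestBelow≤ zero    = z≤n
  largestBelow≤ (suc K) with P? K
  ... | yes _ = n≤1+n K
  ... | no _  = m≤n⇒m≤1+n (largestBelow≤ K)

  largestBelow< : ∀ {K} → 0 < K → largestBelow K < K
  largestBelow< {suc K} _ with P? K
  ... | yes _ = ≤-refl
  ... | no _  = s≤s (largestBelow≤ K)

  largestBelow-satisfies : ∀ {K j} → j < K → P j → P (largestBelow K)
  largestBelow-satisfies {suc K} j<1+K Pj with P? K
  ... | yes PK = PK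
  ... | no ¬PK with m≤n⇒m<n∨m≡n (≤-pred j<1+K)
  ...   | inj₁ j<K = largestBelow-satisfies j<K Pj
  ...   | inj₂ refl = ⊥-elim (¬PK Pj)

  largestBelow-maximal : ∀ {K j} → largestBelow K < j → j < K → ¬ P j
  largestBelow-maximal {suc K} l<j j<1+K with P? K
  ... | yes _ = λ _ → <⇒≱ l<j (≤-pred j<1+K)
  ... | no ¬PK with m≤n⇒m<n∨m≡n (≤-pred j<1+K)
  ...   | inj₁ j<K = largestBelow-maximal l<j j<K
  ...   | inj₂ refl = ¬PK

largestBelow-cong : ∀ {p q} {P : ℕ → Set p} {Q : ℕ → Set q} (P? : ∀ j → Dec (P j)) (Q? : ∀ j → Dec (Q j)) →
                    (∀ {j} → P j → Q j) → (∀ {j} → Q j → P j) → ∀ K → largestBelow P? K ≡ largestBelow Q? K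
largestBelow-cong P? Q? P⇒Q Q⇒P zero = refl
largestBelow-cong P? Q? P⇒Q Q⇒P (suc K) with P? K | Q? K
... | yes _  | yes _  = refl
... | yes PK | no ¬QK = ⊥-elim (¬QK (P⇒Q PK))
... | no ¬PK | yes QK = ⊥-elim (¬PK (Q⇒P QK))
... | no _   | no _   = largestBelow-cong P? Q? P⇒Q Q⇒P K

module FromParkingFunction {n} (w : Vec ℕ n) (pf : IsParkingFunction w) where

  letter : Fin n → ℕ
  letter = lookup w

  multiplicity : ℕ → ℕ
  multiplicity = fibreSize letter

  atMost : ℕ → ℕ
  atMost k = ∑[ i < n ] 𝟙 (letter i ≤? k)

  k≤atMost : ∀ k → 1 ≤ k → k ≤ n → k ≤ atMost k
  k≤atMost k 1≤k k≤n = subst (k ≤_) (count≡∑𝟙 (_≤? k) w) (proj₂ pf k 1≤k k≤n)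

  letter≤n : ∀ i → letter i ≤ n
  letter≤n i = ∑-𝟙≥n⇒all (λ j → letter j ≤? n) (k≤atMost n (≤-trans (s≤s z≤n) (toℕ<n i)) ≤-refl) i

  atMost-n : atMost n ≡ n
  atMost-n = trans (∑-cong {n} (λ i → 𝟙-yes (letter i ≤? n) (letter≤n i))) (∑-const-1 n)

  atMost-suc : ∀ k → atMost (suc k) ≡ atMost k + multiplicity (suc k)
  atMost-suc k = trans (∑-cong {n} split) (∑-distrib-+ (λ i → 𝟙 (letter i ≤? k)) (λ i → 𝟙 (letter i ≟ suc k)))
    where
    split : ∀ i → 𝟙 (letter i ≤? suc k) ≡ 𝟙 (letter i ≤? k) + 𝟙 (letter i ≟ suc k)
    split i = let a = letter i in begin
      𝟙 (a ≤? suc k)                  ≡⟨ 𝟙-cong (a ≤? suc k) (a <? suc (suc k)) s≤s ≤-pred ⟩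
      𝟙 (a <? suc (suc k))            ≡⟨ 𝟙-<-suc a (suc k) ⟩
      𝟙 (a <? suc k) + 𝟙 (a ≟ suc k)  ≡⟨ cong (_+ 𝟙 (a ≟ suc k)) (𝟙-cong (a <? suc k) (a ≤? k) ≤-pred s≤s) ⟩
      𝟙 (a ≤? k) + 𝟙 (a ≟ suc k)      ∎
      where open ≡-Reasoning

  ∑-multiplicity : ∀ K → ∑[ j < K ] multiplicity (suc (toℕ j)) ≡ atMost K
  ∑-multiplicity K = trans (∑-comm {K} {n} (λ j i → 𝟙 (letter i ≟ suc (toℕ j))))
                           (∑-cong {n} (λ i → ∑-𝟙-≡suc K (proj₁ pf i)))

  Opens : Fin n → Set
  Opens x = 0 < multiplicity (suc (toℕ x))

  HasRoom : (Fin n → ℕ) → Fin n → ℕ → Set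
  HasRoom h x j = countBelow (toℕ x) h (suc j) < multiplicity (suc j)

  hasRoom? : ∀ h x j → Dec (HasRoom h x j)
  hasRoom? h x j = countBelow (toℕ x) h (suc j) <? multiplicity (suc j)

  -- x opens the block with minimum x + 1 if that value occurs; otherwise it joins the
  -- last opened block j + 1 that still has room among the points before x.
  step : (Fin n → ℕ) → Fin n → ℕ
  step h x with 0 <? multiplicity (suc (toℕ x))
  ... | yes _ = suc (toℕ x)
  ... | no _  = suc (largestBelow (hasRoom? h x) (toℕ x))

  -- Course-of-values recursion: greedyUpTo k is the greedy assignment on the points below k.
  greedyUpTo : ℕ → Fin n → ℕ
  greedyUpTo zero    y = 0
  greedyUpTo (suc k) y with toℕ y <? k
  ... | yes _ = greedyUpTo k y
  ... | no _  = step (greedyUpTo k) y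

  greedy : Fin n → ℕ
  greedy y = greedyUpTo (suc (toℕ y)) y

  step-opens : ∀ {h} x → Opens x → step h x ≡ suc (toℕ x)
  step-opens x opens with 0 <? multiplicity (suc (toℕ x))
  ... | yes _      = refl
  ... | no ¬opens = ⊥-elim (¬opens opens)

  step-joins : ∀ {h} x → ¬ Opens x → step h x ≡ suc (largestBelow (hasRoom? h x) (toℕ x))
  step-joins x ¬opens with 0 <? multiplicity (suc (toℕ x))
  ... | yes opens = ⊥-elim (¬opens opens)
  ... | no _      = refl

  step-cong : ∀ {h h′} x → (∀ y → toℕ y < toℕ x → h y ≡ h′ y) → step h x ≡ step h′ x
  step-cong {h} {h′} x h≡h′ with 0 <? multiplicity (suc (toℕ x))
  ... | yes _ = refl
  ... | no _  = cong suc (largestBelow-cong (hasRoom? h x) (hasRoom? h′ x)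
                  (subst (_< _) (countBelow-cong (toℕ x) h≡h′ _))
                  (subst (_< _) (sym (countBelow-cong (toℕ x) h≡h′ _))) (toℕ x))

  greedyUpTo-stable : ∀ k y → toℕ y < k → greedyUpTo k y ≡ greedy y
  greedyUpTo-stable (suc k) y y<1+k with toℕ y <? k | m≤n⇒m<n∨m≡n (≤-pred y<1+k)
  ... | yes y<k | _        = greedyUpTo-stable k y y<k
  ... | no y≮k  | inj₁ y<k = ⊥-elim (y≮k y<k)
  ... | no _    | inj₂ refl with toℕ y <? toℕ y
  ...   | yes y<y = ⊥-elim (<-irrefl refl y<y)
  ...   | no _    = refl

  greedy-step : ∀ x → greedy x ≡ step greedy x
  greedy-step x with toℕ x <? toℕ x
  ... | yes x<x = ⊥-elim (<-irrefl refl x<x)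
  ... | no _    = step-cong x (greedyUpTo-stable (toℕ x))

  lastRoom : Fin n → ℕ
  lastRoom x = largestBelow (hasRoom? greedy x) (toℕ x)

  greedy-opens : ∀ x → Opens x → greedy x ≡ suc (toℕ x)
  greedy-opens x opens = trans (greedy-step x) (step-opens x opens)

  greedy-joins : ∀ x → ¬ Opens x → greedy x ≡ suc (lastRoom x)
  greedy-joins x ¬opens = trans (greedy-step x) (step-joins x ¬opens)

  greedy≤suc : ∀ x → greedy x ≤ suc (toℕ x)
  greedy≤suc x with 0 <? multiplicity (suc (toℕ x))
  ... | yes opens = ≤-reflexive (greedy-opens x opens)
  ... | no ¬opens = subst (_≤ suc (toℕ x)) (sym (greedy-joins x ¬opens)) (s≤s (largestBelow≤ _ (toℕ x)))

  1≤greedy : ∀ x → 1 ≤ greedy x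
  1≤greedy x with 0 <? multiplicity (suc (toℕ x))
  ... | yes opens = subst (1 ≤_) (sym (greedy-opens x opens)) (s≤s z≤n)
  ... | no ¬opens = subst (1 ≤_) (sym (greedy-joins x ¬opens)) (s≤s z≤n)

  lastRoom-hasRoom : ∀ x → ¬ Opens x → lastRoom x < toℕ x × HasRoom greedy x (lastRoom x)
  lastRoom-hasRoom x ¬opens =
    largestBelow< (hasRoom? greedy x) (≤-trans (s≤s z≤n) (toℕ<n j)) ,
    largestBelow-satisfies (hasRoom? greedy x) (toℕ<n j) room
    where
    -- The x points before x fill x places, but by the parking condition the blocks opened
    -- before x have at least x + 1 places.
    fewer : ∑[ j < toℕ x ] countBelow (toℕ x) greedy (suc (toℕ j)) < ∑[ j < toℕ x ] multiplicity (suc (toℕ j))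
    fewer = begin-strict
      ∑[ j < toℕ x ] countBelow (toℕ x) greedy (suc (toℕ j))  ≡⟨ ∑-countBelow 1≤greedy greedy≤suc (toℕ x) (<⇒≤ (toℕ<n x)) ⟩
      toℕ x                                                   <⟨ k≤atMost (suc (toℕ x)) (s≤s z≤n) (toℕ<n x) ⟩
      atMost (suc (toℕ x))                                    ≡⟨ atMost-suc (toℕ x) ⟩
      atMost (toℕ x) + multiplicity (suc (toℕ x))             ≡⟨ cong (atMost (toℕ x) +_) (n≤0⇒n≡0 (≮⇒≥ ¬opens)) ⟩
      atMost (toℕ x) + 0                                      ≡⟨ +-identityʳ _ ⟩
      atMost (toℕ x)                                          ≡⟨ ∑-multiplicity (toℕ x) ⟨
      ∑[ j < toℕ x ] multiplicity (suc (toℕ j))               ∎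
      where open ≤-Reasoning
    pigeonhole = ∑-<⇒∃< (λ j → countBelow (toℕ x) greedy (suc (toℕ j))) (λ j → multiplicity (suc (toℕ j))) fewer
    j    = proj₁ pigeonhole
    room = proj₂ pigeonhole

  room-for-greedy : ∀ x → countBelow (toℕ x) greedy (greedy x) < multiplicity (greedy x)
  room-for-greedy x with 0 <? multiplicity (suc (toℕ x))
  ... | yes opens rewrite greedy-opens x opens | countBelow-fresh greedy≤suc (toℕ x) = opens
  ... | no ¬opens rewrite greedy-joins x ¬opens = proj₂ (lastRoom-hasRoom x ¬opens)

  countBelow≤multiplicity : ∀ k → k ≤ n → ∀ v → countBelow k greedy v ≤ multiplicity v
  countBelow≤multiplicity zero    _     v = ≤-trans (≤-reflexive (∑-const-0 n)) z≤n
  countBelow≤multiplicity (suc k) 1+k≤n v =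
    subst (λ m → countBelow (suc m) greedy v ≤ multiplicity v) (toℕ-fromℕ< 1+k≤n)
      (extend (subst (λ m → countBelow m greedy v ≤ multiplicity v) (sym (toℕ-fromℕ< 1+k≤n))
                     (countBelow≤multiplicity k (<⇒≤ 1+k≤n) v)))
    where
    x = Fin.fromℕ< 1+k≤n
    extend : countBelow (toℕ x) greedy v ≤ multiplicity v → countBelow (suc (toℕ x)) greedy v ≤ multiplicity v
    extend below rewrite countBelow-suc greedy x v with greedy x ≟ v
    ... | no _     = subst (_≤ multiplicity v) (sym (+-identityʳ _)) below
    ... | yes refl = subst (_≤ multiplicity v) (+-comm 1 _) (room-for-greedy x)

  fibreSize-greedy : ∀ {v} → 1 ≤ v → v ≤ n → fibreSize greedy v ≡ multiplicity v
  fibreSize-greedy {suc v} _ v<n = trans (sym (countBelow-all greedy (suc v)))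
    (subst (λ m → countBelow n greedy (suc m) ≡ multiplicity (suc m)) (toℕ-fromℕ< v<n)
      (∑-≤∧≡⇒≗ (λ j → countBelow≤multiplicity n ≤-refl (suc (toℕ j))) total (Fin.fromℕ< v<n)))
    where
    total : ∑[ j < n ] countBelow n greedy (suc (toℕ j)) ≡ ∑[ j < n ] multiplicity (suc (toℕ j))
    total = trans (∑-countBelow 1≤greedy greedy≤suc n ≤-refl) (sym (trans (∑-multiplicity n) atMost-n))

  noRoomAbove : ∀ x {v} → ¬ Opens x → greedy x < v → v ≤ toℕ x → ¬ countBelow (toℕ x) greedy v < multiplicity v
  noRoomAbove x {suc j} ¬opens gx<v v≤x =
    largestBelow-maximal (hasRoom? greedy x) (≤-pred (subst (_< suc j) (greedy-joins x ¬opens) gx<v)) v≤x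

  stillRoom : ∀ {x y} → toℕ x ≤ toℕ y → countBelow (toℕ x) greedy (greedy y) < multiplicity (greedy y)
  stillRoom {x} {y} x≤y = <-≤-trans (countBelow<fibreSize greedy x≤y)
    (≤-trans (≤-reflexive (sym (countBelow-all greedy (greedy y)))) (countBelow≤multiplicity n ≤-refl (greedy y)))

  ¬Opens : ∀ {a c} → toℕ a < toℕ c → greedy c ≤ greedy a → ¬ Opens c
  ¬Opens {a} {c} a<c gc≤ga opens =
    <⇒≱ a<c (≤-pred (subst (_≤ suc (toℕ a)) (greedy-opens c opens) (≤-trans gc≤ga (greedy≤suc a))))

  greedy-nonCrossing : ∀ {a b c d} → a Fin.< b → b Fin.< c → c Fin.< d →
                       greedy a ≡ greedy c → greedy b ≡ greedy d → greedy a ≡ greedy b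
  greedy-nonCrossing {a} {b} {c} {d} a<b b<c c<d ga≡gc gb≡gd = ≤-antisym ga≤gb gb≤ga
    where
    gb≤ga : greedy b ≤ greedy a
    gb≤ga = ≮⇒≥ λ ga<gb →
      noRoomAbove c (¬Opens (<-trans a<b b<c) (≤-reflexive (sym ga≡gc))) (subst (_< greedy b) ga≡gc ga<gb)
        (≤-trans (greedy≤suc b) b<c)
        (subst (λ v → countBelow (toℕ c) greedy v < multiplicity v) (sym gb≡gd) (stillRoom (<⇒≤ c<d)))
    ga≤gb : greedy a ≤ greedy b
    ga≤gb = ≮⇒≥ λ gb<ga →
      noRoomAbove b (¬Opens a<b gb≤ga) gb<ga (≤-trans (greedy≤suc a) a<b)
        (subst (λ v → countBelow (toℕ b) greedy v < multiplicity v) (sym ga≡gc) (stillRoom (<⇒≤ b<c)))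

  greedy-attained : ∀ x → ∃ λ e → greedy e ≡ greedy x × suc (toℕ e) ≡ greedy x
  greedy-attained x with greedy x | 1≤greedy x | greedy≤suc x | room-for-greedy x
  ... | suc j | _ | j≤x | room = e , trans (greedy-opens e e-opens) e+1≡ , e+1≡
    where
    j<n = <-≤-trans (s≤s (≤-pred j≤x)) (toℕ<n x)
    e = Fin.fromℕ< j<n
    e+1≡ = cong suc (toℕ-fromℕ< j<n)
    e-opens : Opens e
    e-opens = subst (λ m → 0 < multiplicity (suc m)) (sym (toℕ-fromℕ< j<n)) (≤-trans (s≤s z≤n) room)

  greedy-isBlockMinima : IsBlockMinima greedy
  greedy-isBlockMinima = record
    { ≤suc        = greedy≤suc
    ; attained    = greedy-attained
    ; nonCrossing = greedy-nonCrossing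
    }

  values : List ℕ
  values = List.filter (λ v → 0 <? multiplicity v) (List.applyUpTo suc n)

  ∈-values⁺ : ∀ {v} → 1 ≤ v → v ≤ n → 0 < multiplicity v → v ∈ₗ values
  ∈-values⁺ {suc j} _ j<n 0<mult = ∈-filter⁺ (λ v → 0 <? multiplicity v) (∈-applyUpTo⁺ suc j<n) 0<mult

  ∈-values⁻ : ∀ {v} → v ∈ₗ values → 1 ≤ v × v ≤ n × 0 < multiplicity v
  ∈-values⁻ v∈ with ∈-filter⁻ (λ v → 0 <? multiplicity v) {xs = List.applyUpTo suc n} v∈
  ... | v∈upTo , 0<mult with ∈-applyUpTo⁻ suc v∈upTo
  ...   | j , j<n , refl = s≤s z≤n , j<n , 0<mult

  values-distinct : AllPairs _≢_ values
  values-distinct = AllPairsP.filter⁺ _ (AllPairsP.applyUpTo⁺₁ suc n (λ i<j _ → <⇒≢ (s≤s i<j)))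

  letter-∈-values : ∀ i → letter i ∈ₗ values
  letter-∈-values i = ∈-values⁺ (proj₁ pf i) (letter≤n i) (fibreSize-pos letter i)

  greedy-∈-values : ∀ x → greedy x ∈ₗ values
  greedy-∈-values x =
    ∈-values⁺ (1≤greedy x) (≤-trans (greedy≤suc x) (toℕ<n x)) (≤-trans (s≤s z≤n) (room-for-greedy x))

  fibreSize-greedy-values : ∀ {v} → v ∈ₗ values → fibreSize greedy v ≡ multiplicity v
  fibreSize-greedy-values v∈ = let 1≤v , v≤n , _ = ∈-values⁻ v∈ in fibreSize-greedy 1≤v v≤n

  blockPair : ℕ → Subset n × Subset n
  blockPair v = levelSet greedy v , levelSet letter v

  triple : Triple n
  triple = List.map blockPair values

  triple-∈Π² : InΠ² triple
  triple-∈Π² =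
    (subst IsSetPartition (ListP.map-∘ values) greedy-partition ,
     AllPairsP.map⁺ (AllPairsP.map⁺ (AllPairs.map nonCrossingPair values-distinct))) ,
    subst IsSetPartition (ListP.map-∘ values) letter-partition ,
    AllP.map⁺ (All.tabulate sameSize)
    where
    greedy-partition : IsSetPartition (List.map (levelSet greedy) values)
    greedy-partition = levelSets-isSetPartition greedy values-distinct
      (All.tabulate (λ v∈ → subst (0 <_) (sym (fibreSize-greedy-values v∈)) (proj₂ (proj₂ (∈-values⁻ v∈)))))
      greedy-∈-values
    letter-partition : IsSetPartition (List.map (levelSet letter) values)
    letter-partition = levelSets-isSetPartition letter values-distinct
      (All.tabulate (proj₂ ∘ proj₂ ∘ ∈-values⁻)) letter-∈-values
    nonCrossingPair : ∀ {u v} → u ≢ v → NonCrossingPair (levelSet greedy u) (levelSet greedy v)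
    nonCrossingPair u≢v = levelSet-noCrossing greedy-isBlockMinima u≢v , levelSet-noCrossing greedy-isBlockMinima (u≢v ∘ sym)
    sameSize : ∀ {v} → v ∈ₗ values → ∣ levelSet greedy v ∣ ≡ ∣ levelSet letter v ∣
    sameSize {v} v∈ = begin
      ∣ levelSet greedy v ∣  ≡⟨ ∣levelSet∣ greedy v ⟩
      fibreSize greedy v     ≡⟨ fibreSize-greedy-values v∈ ⟩
      multiplicity v         ≡⟨ ∣levelSet∣ letter v ⟨
      ∣ levelSet letter v ∣  ∎
      where open ≡-Reasoning

  toWord-triple : toWord triple ≡ w
  toWord-triple = trans (tabulate-cong letterAt-triple) (tabulate∘lookup w)
    where
    letterAt-triple : ∀ i → letterAt triple i ≡ letter i
    letterAt-triple i =
      let x , gx≡ = fibreSize-pos⇒∃ greedy (letter i)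
                      (subst (0 <_) (sym (fibreSize-greedy-values (letter-∈-values i))) (fibreSize-pos letter i))
      in begin
      letterAt triple i                    ≡⟨ letterAt-∈ (AllPairsP.map⁺ (AllPairs.map (levelSet-disjoint letter) values-distinct))
                                                (∈-map⁺ blockPair (letter-∈-values i)) (∈-levelSet⁺ letter refl) ⟩
      minElt (levelSet greedy (letter i))  ≡⟨ cong (minElt ∘ levelSet greedy) gx≡ ⟨
      minElt (levelSet greedy (greedy x))  ≡⟨ minElt-levelSet greedy-isBlockMinima x ⟩
      greedy x                             ≡⟨ gx≡ ⟩
      letter i                             ∎
      where open ≡-Reasoning

toWord-surjective : ∀ {n} (w : Vec ℕ n) → IsParkingFunction w → Σ (Triple n) (λ t → InΠ² t × toWord t ≡ w)
toWord-surjective w pf = triple , triple-∈Π² , toWord-triple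
  where open FromParkingFunction w pf

proposition17 : ∀ (n : ℕ) →
    (∀ (t t′ : Triple n) → InΠ² t → InΠ² t′ → t ↭ t′ → toWord t ≡ toWord t′) ×
    (∀ (t : Triple n) → InΠ² t → IsParkingFunction (toWord t)) ×
    (∀ (t t′ : Triple n) → InΠ² t → InΠ² t′ → toWord t ≡ toWord t′ → t ↭ t′) ×
    (∀ (w : Vec ℕ n) → IsParkingFunction w → Σ (Triple n) (λ t → InΠ² t × toWord t ≡ w)) ×
    (∀ (σ : Permutation′ n) (t : Triple n) → InΠ² t → toWord (actTriple σ t) ≡ actWord σ (toWord t))
proposition17 n =
  (λ _ _ → toWord-resp-↭) ,
  (λ _ → Π².isParkingFunction) ,
  (λ _ _ → toWord-injective) ,
  toWord-surjective ,
  (λ σ t _ → toWord-equivariant σ t)
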